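{- Let $R$ be a commutative ring with unity, $P\in R[x_1,\dots,x_n]$, and let $(J_0,\dots,J_l,d_0,\dots,d_{m-1})$ be an upper Rado functional of order $m\ge1$ for $P$. Then there is an integer $s\neq0$ such that for all $i\in\{0,\dots,m-1\}$, all $\beta_i\in J_i$ and all $\alpha\in J_m$, $$|\beta_i|=|\alpha|+\frac{d_i}{s}.$$
   Context: $\operatorname{supp}(P)\subseteq\mathbb{N}_0^n$ is the set of exponent vectors of monomials of $P$ with nonzero coefficient; $|\alpha|=\alpha(1)+\dots+\alpha(n)$. For $\vec t\in\mathbb{N}^n$, $\alpha\cdot\vec t=\sum_j\alpha(j)t_j$. An upper Rado functional of order $m$ ($0\le m\le l$) is a tuple $(J_0,\dots,J_l,d_0,\dots,d_{m-1})$, with $J_0,\dots,J_l$ a partition of $\operatorname{supp}(P)$ into nonempty sets and $d_i\in\mathbb{N}$, such that for every $r\in\mathbb{N}$ and every finite coloring $c$ of $\mathbb{N}$ there are infinitely many $\vec t\in\mathbb{N}^n$ with $c(t_1)=\dots=c(t_n)$ for which there exist integers $M_0>\dots>M_l$ with $J_i=\{\alpha\in\operatorname{supp}(P):\alpha\cdot\vec t=M_i\}$ for all $i$, $M_i-M_m=d_i$ for $i\in\{0,\dots,m-1\}$, and (if $m<l$) $M_m-M_{m+1}\ge r$. -}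

module Defs where

open import Level using (Level; _⊔_; 0ℓ)
open import Algebra.Bundles using (CommutativeRing)
open import Data.Nat as ℕ using (ℕ; _≤_; _<_; s≤s)
import Data.Nat.Properties as ℕP
open import Data.Integer as ℤ using (ℤ; +_)
open import Data.Fin using (Fin; inject≤; fromℕ<)
open import Data.Vec using (Vec; lookup; zipWith; sum)
open import Data.List using (List)
open import Data.List.Membership.Propositional using (_∈_)
open import Data.Product using (Σ; ∃; _×_)
open import Function.Bundles using (_⇔_)
open import Relation.Nullary using (¬_)
open import Relation.Binary.PropositionalEquality using (_≡_)
open import Relation.Unary using (Pred)

Exp : ℕ → Set
Exp n = Vec ℕ n

-- A polynomial in R[x_1,…,x_n]: a coefficient function on exponent vectors
-- with finite support (every exponent with nonzero coefficient lies in a finite list).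
record Poly {c ℓ : Level} (R : CommutativeRing c ℓ) (n : ℕ) : Set (c ⊔ ℓ) where
  open CommutativeRing R
  field
    coeff  : Exp n → Carrier
    monos  : List (Exp n)
    finite : ∀ α → ¬ (coeff α ≈ 0#) → α ∈ monos

supp : ∀ {c ℓ} {R : CommutativeRing c ℓ} {n} → Poly R n → Pred (Exp n) ℓ
supp {R = R} P α = ¬ (CommutativeRing._≈_ R (Poly.coeff P α) (CommutativeRing.0# R))

∣_∣ₑ : ∀ {n} → Exp n → ℕ
∣ α ∣ₑ = sum α

_·_ : ∀ {n} → Exp n → Vec ℕ n → ℕ
α · t = sum (zipWith ℕ._*_ α t)

-- t ∈ ℕ^n with ℕ = {1,2,…}
Positive : ∀ {n} → Vec ℕ n → Set
Positive t = ∀ j → 1 ≤ lookup t j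

Monochromatic : ∀ {n k} → (ℕ → Fin k) → Vec ℕ n → Set
Monochromatic c t = ∀ j j' → c (lookup t j) ≡ c (lookup t j')

-- index m and i ∈ {0,…,m-1} viewed as elements of {0,…,l}
idxₘ : ∀ {l m} → m ≤ l → Fin (ℕ.suc l)
idxₘ m≤l = fromℕ< (s≤s m≤l)

idxᵢ : ∀ {l m} → m ≤ l → Fin m → Fin (ℕ.suc l)
idxᵢ {l} m≤l i = inject≤ i (ℕP.≤-trans m≤l (ℕP.n≤1+n l))

record UpperRado {c ℓ} {R : CommutativeRing c ℓ} {n : ℕ} (P : Poly R n)
                 (l m : ℕ) (m≤l : m ≤ l)
                 (J : Fin (ℕ.suc l) → Pred (Exp n) 0ℓ) (d : Fin m → ℕ)
                 : Set (c ⊔ ℓ) where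
  field
    J⊆supp   : ∀ i α → J i α → supp P α
    nonempty : ∀ i → ∃ λ α → J i α
    disjoint : ∀ i j α → J i α → J j α → i ≡ j
    cover    : ∀ α → supp P α → ∃ λ i → J i α
    d-pos    : ∀ i → 1 ≤ d i
    -- the Rado property; "infinitely many t" = for every finite list of
    -- vectors there is a suitable t outside it
    rado : ∀ (r k : ℕ) (col : ℕ → Fin k) (L : List (Vec ℕ n)) →
      Σ (Vec ℕ n) λ t →
        ¬ (t ∈ L) × Positive t × Monochromatic col t ×
        Σ (Fin (ℕ.suc l) → ℤ) λ M →
          (∀ i j → Data.Fin.toℕ i < Data.Fin.toℕ j → M j ℤ.< M i) ×
          (∀ i α → (J i α ⇔ (supp P α × (+ (α · t)) ≡ M i))) ×
          (∀ (i : Fin m) → M (idxᵢ m≤l i) ℤ.- M (idxₘ m≤l) ≡ + d i) ×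
          (∀ (m<l : m < l) → + r ℤ.≤ M (idxₘ m≤l) ℤ.- M (fromℕ< (s≤s m<l)))

-- Colour ℕ by residues modulo N.  A monochromatic t has all t_j ≡ c (mod N), hence
-- α · t ≡ |α| c, and d_i = M_i − M_m = β · t − α · t ≡ (|β| − |α|) c (mod N) with one c
-- for all i, β ∈ J_i, α ∈ J_m.  Writing g = |β| − |α|, two such pairs (g, d), (g₀, d₀)
-- satisfy g₀ d ≡ g d₀ modulo every N, so g₀ d = g d₀.  As d₀ ≠ 0 is not ≡ 0 modulo
-- every N, g₀ ≠ 0; taking N = |g₀| shows g₀ ∣ d₀, and s = d₀ / g₀ is the required ratio.
module Submission where

open import Defs
open import Level using (0ℓ)
open import Algebra.Bundles using (CommutativeRing)
open import Data.Nat using (ℕ; suc; _≤_)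
open import Data.Integer using (ℤ; +_; _*_; _-_)
open import Data.Fin using (Fin)
open import Data.Product using (Σ; _×_)
open import Relation.Nullary using (¬_)
open import Relation.Binary.PropositionalEquality using (_≡_)
open import Relation.Unary using (Pred)

import Data.Nat as ℕ
import Data.Nat.Properties as ℕ
import Data.Nat.Divisibility as ℕ
open import Data.Nat.DivMod using (_%_; _/_; m≡m%n+[m/n]*n; m%n<n)
open import Data.Integer using (_+_; 0ℤ; ∣_∣; ≢-nonZero)
open import Data.Integer.Properties using (pos-+; pos-*; +-injective; ∣i∣≡0⇒i≡0; i-j≡0⇒i≡j; *-cancelˡ-≡)
open import Data.Integer.Divisibility.Signed
open import Data.Integer.Tactic.RingSolver using (solve-∀)
import Data.Fin as Fin
open import Data.Fin using (fromℕ<; toℕ; zero)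
open import Data.Fin.Properties using (toℕ-fromℕ<)
open import Data.Vec using (Vec; []; _∷_; lookup)
open import Data.List using ([])
open import Data.Product using (_,_; proj₁; proj₂; Σ-syntax)
open import Function.Bundles using (Equivalence)
open import Relation.Nullary using (contradiction)
open import Relation.Binary.PropositionalEquality using (_≢_; sym; trans; cong; cong₂; subst; module ≡-Reasoning)

divisible-by-all⇒≡0 : ∀ {x} → (∀ N → .{{ℕ.NonZero N}} → + N ∣ x) → x ≡ 0ℤ
divisible-by-all⇒≡0 {x} N∣x with ∣ x ∣ in ∣x∣≡ | ∣⇒∣ᵤ (N∣x (suc ∣ x ∣))
... | ℕ.zero  | _       = ∣i∣≡0⇒i≡0 ∣x∣≡
... | suc k   | 2+k∣1+k = contradiction 2+k∣1+k (ℕ.>⇒∤ (ℕ.n<1+n (suc k)))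

cross-difference : ∀ a b x y c → a * (y - b * c) - b * (x - a * c) ≡ a * y - b * x
cross-difference = solve-∀

remove-multiple : ∀ x y c → (x - y * c) + y * c ≡ x
remove-multiple = solve-∀

minus-zero-multiple : ∀ x c → x - 0ℤ * c ≡ x
minus-zero-multiple = solve-∀

swap-outer : ∀ a b c → a * (b * c) ≡ c * (b * a)
swap-outer = solve-∀

module CommonRatio {I : Set} (g D : I → ℤ)
  (congruent : ∀ N → .{{ℕ.NonZero N}} → Σ[ c ∈ ℤ ] ∀ i → + N ∣ D i - g i * c) where

  cross-multiplied : ∀ i j → g i * D j ≡ g j * D i
  cross-multiplied i j = i-j≡0⇒i≡j _ _ (divisible-by-all⇒≡0 N∣cross)
    where
    N∣cross : ∀ N → .{{ℕ.NonZero N}} → + N ∣ g i * D j - g j * D i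
    N∣cross N with congruent N
    ... | c , N∣D-gc = subst (+ N ∣_) (cross-difference (g i) (g j) (D i) (D j) c)
                         (∣m∣n⇒∣m-n (∣n⇒∣m*n (g i) (N∣D-gc j)) (∣n⇒∣m*n (g j) (N∣D-gc i)))

  D≢0⇒g≢0 : ∀ i → D i ≢ 0ℤ → g i ≢ 0ℤ
  D≢0⇒g≢0 i D≢0 g≡0 = D≢0 (divisible-by-all⇒≡0 N∣D)
    where
    N∣D : ∀ N → .{{ℕ.NonZero N}} → + N ∣ D i
    N∣D N with congruent N
    ... | c , N∣D-gc = subst (+ N ∣_) (minus-zero-multiple (D i) c)
                         (subst (λ y → + N ∣ D i - y * c) g≡0 (N∣D-gc i))

  g∣D : ∀ i → g i ≢ 0ℤ → g i ∣ D i
  g∣D i g≢0 with congruent ∣ g i ∣ {{≢-nonZero g≢0}}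
  ... | c , ∣g∣∣D-gc = ∣-trans (m∣∣m∣ {g i})
        (subst (+ ∣ g i ∣ ∣_) (remove-multiple (D i) (g i) c)
          (∣m∣n⇒∣m+n (∣g∣∣D-gc i) (∣m⇒∣m*n c (∣m∣∣m {g i}))))

  common-ratio : ∀ i₀ → D i₀ ≢ 0ℤ → Σ[ s ∈ ℤ ] s ≢ 0ℤ × ∀ i → s * g i ≡ D i
  common-ratio i₀ D₀≢0 = s , s≢0 , s*g≡D
    where
    g₀≢0 : g i₀ ≢ 0ℤ
    g₀≢0 = D≢0⇒g≢0 i₀ D₀≢0

    g₀∣D₀ : g i₀ ∣ D i₀
    g₀∣D₀ = g∣D i₀ g₀≢0

    s : ℤ
    s = quotient g₀∣D₀

    D₀≡sg₀ : D i₀ ≡ s * g i₀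
    D₀≡sg₀ = _∣_.equality g₀∣D₀

    s≢0 : s ≢ 0ℤ
    s≢0 s≡0 = D₀≢0 (trans D₀≡sg₀ (cong (_* g i₀) s≡0))

    s*g≡D : ∀ i → s * g i ≡ D i
    s*g≡D i = *-cancelˡ-≡ (g i₀) (s * g i) (D i) {{≢-nonZero g₀≢0}} (begin
      g i₀ * (s * g i) ≡⟨ swap-outer (g i₀) s (g i) ⟩
      g i * (s * g i₀) ≡⟨ cong (g i *_) D₀≡sg₀ ⟨
      g i * D i₀       ≡⟨ cross-multiplied i₀ i ⟨
      g i₀ * D i       ∎)
      where open ≡-Reasoning

add-sub-cancel : ∀ r q → (r + q) - r ≡ q
add-sub-cancel = solve-∀

residue : ∀ N .{{_ : ℕ.NonZero N}} → ℕ → Fin N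
residue N y = fromℕ< (m%n<n y N)

n∣m-m%n : ∀ N .{{_ : ℕ.NonZero N}} y → + N ∣ + y - + (y % N)
n∣m-m%n N y = divides (+ (y / N)) (begin
  + y - + (y % N)
    ≡⟨ cong (λ z → + z - + (y % N)) (m≡m%n+[m/n]*n y N) ⟩
  + (y % N ℕ.+ y / N ℕ.* N) - + (y % N)
    ≡⟨ cong (_- + (y % N)) (trans (pos-+ (y % N) _) (cong (_+_ (+ (y % N))) (pos-* (y / N) N))) ⟩
  (+ (y % N) + + (y / N) * + N) - + (y % N)
    ≡⟨ add-sub-cancel (+ (y % N)) (+ (y / N) * + N) ⟩
  + (y / N) * + N ∎)
  where open ≡-Reasoning

monochromatic⇒congruent : ∀ N .{{_ : ℕ.NonZero N}} {n} (t : Vec ℕ n) → Monochromatic (residue N) t →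
                          Σ[ c ∈ ℤ ] ∀ j → + N ∣ + lookup t j - c
monochromatic⇒congruent N []      _    = 0ℤ , λ ()
monochromatic⇒congruent N (x ∷ t) mono = + (x % N) , λ j →
  subst (λ r → + N ∣ + lookup (x ∷ t) j - + r) (same-residue j) (n∣m-m%n N (lookup (x ∷ t) j))
  where
  same-residue : ∀ j → lookup (x ∷ t) j % N ≡ x % N
  same-residue j = begin
    lookup (x ∷ t) j % N             ≡⟨ toℕ-fromℕ< (m%n<n (lookup (x ∷ t) j) N) ⟨
    toℕ (residue N (lookup (x ∷ t) j)) ≡⟨ cong toℕ (mono j zero) ⟩
    toℕ (residue N x)                ≡⟨ toℕ-fromℕ< (m%n<n x N) ⟩
    x % N                            ∎
    where open ≡-Reasoning

empty-dot : ∀ c N → 0ℤ - 0ℤ * c ≡ 0ℤ * N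
empty-dot = solve-∀

dot-step : ∀ a x S A c → (a * x + S) - (a + A) * c ≡ a * (x - c) + (S - A * c)
dot-step = solve-∀

dot-congruent : ∀ {N n} (α t : Vec ℕ n) c → (∀ j → + N ∣ + lookup t j - c) →
                + N ∣ + (α · t) - + ∣ α ∣ₑ * c
dot-congruent {N} []      []      c _      = divides 0ℤ (empty-dot c (+ N))
dot-congruent {N} (a ∷ α) (x ∷ t) c t≡c = subst (+ N ∣_) (sym split)
  (∣m∣n⇒∣m+n (∣n⇒∣m*n (+ a) (t≡c zero)) (dot-congruent α t c (λ j → t≡c (Fin.suc j))))
  where
  split : + (a ℕ.* x ℕ.+ α · t) - + (a ℕ.+ ∣ α ∣ₑ) * c ≡ + a * (+ x - c) + (+ (α · t) - + ∣ α ∣ₑ * c)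
  split = begin
    + (a ℕ.* x ℕ.+ α · t) - + (a ℕ.+ ∣ α ∣ₑ) * c
      ≡⟨ cong₂ (λ u v → u - v * c) (trans (pos-+ (a ℕ.* x) _) (cong (_+ _) (pos-* a x))) (pos-+ a _) ⟩
    (+ a * + x + + (α · t)) - (+ a + + ∣ α ∣ₑ) * c
      ≡⟨ dot-step (+ a) (+ x) (+ (α · t)) (+ ∣ α ∣ₑ) c ⟩
    + a * (+ x - c) + (+ (α · t) - + ∣ α ∣ₑ * c) ∎
    where open ≡-Reasoning

gap-difference : ∀ X Y b a c → (X - b * c) - (Y - a * c) ≡ (X - Y) - (b - a) * c
gap-difference = solve-∀

module _ {c ℓ} {R : CommutativeRing c ℓ} {n : ℕ} {P : Poly R n} {l m : ℕ} {m≤l : m ≤ l}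
         {J : Fin (suc l) → Pred (Exp n) 0ℓ} {d : Fin m → ℕ} (U : UpperRado P l m m≤l J d) where
  open UpperRado U

  UpperPair : Set
  UpperPair = Σ[ i ∈ Fin m ] Σ[ β ∈ Exp n ] Σ[ α ∈ Exp n ] J (idxᵢ m≤l i) β × J (idxₘ m≤l) α

  degree-gap : UpperPair → ℤ
  degree-gap (_ , β , α , _) = + ∣ β ∣ₑ - + ∣ α ∣ₑ

  shift : UpperPair → ℤ
  shift (i , _) = + d i

  shift-congruent : ∀ N .{{_ : ℕ.NonZero N}} →
                    Σ[ c ∈ ℤ ] ∀ p → + N ∣ shift p - degree-gap p * c
  -- One monochromatic t per modulus suffices.
  shift-congruent N with rado 0 N (residue N) []
  ... | t , _ , _ , mono , M , _ , J⇔ , M-gap , _ with monochromatic⇒congruent N t mono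
  ... | c , t≡c = c , congruent
    where
    congruent : ∀ p → + N ∣ shift p - degree-gap p * c
    congruent (i , β , α , β∈Jᵢ , α∈Jₘ) =
      subst (λ D → + N ∣ D - (+ ∣ β ∣ₑ - + ∣ α ∣ₑ) * c) dots≡d
        (subst (+ N ∣_) (gap-difference (+ (β · t)) (+ (α · t)) (+ ∣ β ∣ₑ) (+ ∣ α ∣ₑ) c)
          (∣m∣n⇒∣m-n (dot-congruent β t c t≡c) (dot-congruent α t c t≡c)))
      where
      open ≡-Reasoning
      dots≡d : + (β · t) - + (α · t) ≡ + d i
      dots≡d = begin
        + (β · t) - + (α · t)         ≡⟨ cong₂ _-_ (proj₂ (Equivalence.to (J⇔ _ β) β∈Jᵢ))
                                                   (proj₂ (Equivalence.to (J⇔ _ α) α∈Jₘ)) ⟩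
        M (idxᵢ m≤l i) - M (idxₘ m≤l) ≡⟨ M-gap i ⟩
        + d i                         ∎

corollary2p11 : ∀ {c ℓ} (R : CommutativeRing c ℓ) (n : ℕ) (P : Poly R n)
    (l m : ℕ) → 1 ≤ m → (m≤l : m ≤ l)
    (J : Fin (suc l) → Pred (Exp n) 0ℓ) (d : Fin m → ℕ) →
    UpperRado P l m m≤l J d →
    Σ ℤ λ s → ¬ (s ≡ + 0) ×
      (∀ (i : Fin m) (β α : Exp n) → J (idxᵢ m≤l i) β → J (idxₘ m≤l) α →
        s * (+ ∣ β ∣ₑ - + ∣ α ∣ₑ) ≡ + d i)
corollary2p11 R n P l (suc m) _ m≤l J d U =
  let s , s≢0 , s*gap≡shift = common-ratio p₀ d₀≢0
  in s , s≢0 , λ i β α β∈Jᵢ α∈Jₘ → s*gap≡shift (i , β , α , β∈Jᵢ , α∈Jₘ)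
  where
  open UpperRado U
  open CommonRatio (degree-gap U) (shift U) (shift-congruent U)
  p₀ : UpperPair U
  p₀ = zero , proj₁ (nonempty _) , proj₁ (nonempty _) , proj₂ (nonempty _) , proj₂ (nonempty _)
  d₀≢0 : + d zero ≢ 0ℤ
  d₀≢0 d₀≡0 = ℕ.<⇒≢ (d-pos zero) (sym (+-injective d₀≡0))
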